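{- A Dyck path $\mathfrak p\in D_n^A$ with height sequence $(h_1,\dots,h_n)$ is regular in the Heyting algebra $\mathcal{D}_n^A$ if and only if for every $i\in[n]$ either $h_i=i$, or $h_i=c>i$ and $h_i=h_{i+1}=\dots=h_c=c$.
   Context: $D_n^A$: words of length $2n$ over $\{u,r\}$ with exactly $n$ $u$'s and $n$ $r$'s in which every prefix has at least as many $u$'s as $r$'s. Height sequence $(h_1,\dots,h_n)$: $h_i$ is the number of $u$'s preceding the $i$-th $r$. $\mathcal{D}_n^A$ is $D_n^A$ with componentwise order of height sequences; it is a finite distributive lattice, hence a Heyting algebra. The least element has height sequence $(1,2,\dots,n)$. The relative pseudocomplement $x\to y$ is the greatest $z$ with $x\wedge z\le y$; the pseudocomplement is $x^{\mathsf c}=x\to\hat0$; $x$ is regular if $(x^{\mathsf c})^{\mathsf c}=x$. -}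

module Defs where

open import Data.Nat using (ℕ; zero; suc; _+_; _*_; _≤_; _<_)
open import Data.List using (List; []; _∷_; length; take)
open import Data.Product using (Σ; _×_; ∃-syntax)
open import Data.Sum using (_⊎_)
open import Relation.Binary.PropositionalEquality using (_≡_)

data Letter : Set where
  u r : Letter

#u : List Letter → ℕ
#u []       = 0
#u (u ∷ w)  = suc (#u w)
#u (r ∷ w)  = #u w

#r : List Letter → ℕ
#r []       = 0
#r (u ∷ w)  = #r w
#r (r ∷ w)  = suc (#r w)

record DyckA (n : ℕ) : Set where
  constructor dyck
  field
    word     : List Letter
    len      : length word ≡ 2 * n
    countU   : #u word ≡ n
    countR   : #r word ≡ n
    prefixes : ∀ k → #r (take k word) ≤ #u (take k word)
open DyckA public

-- heightAux k w i : number of u's preceding the i-th r (1-indexed) of w,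
-- given that k u's have already been read.  (Junk value 0 if out of range.)
heightAux : ℕ → List Letter → ℕ → ℕ
heightAux k []      i             = 0
heightAux k (u ∷ w) i             = heightAux (suc k) w i
heightAux k (r ∷ w) zero          = 0
heightAux k (r ∷ w) (suc zero)    = k
heightAux k (r ∷ w) (suc (suc i)) = heightAux k w (suc i)

h : ∀ {n} → DyckA n → ℕ → ℕ
h p i = heightAux 0 (word p) i

_≼_ : ∀ {n} → DyckA n → DyckA n → Set
_≼_ {n} p q = ∀ i → 1 ≤ i → i ≤ n → h p i ≤ h q i

-- p ≤ 0̂, where 0̂ is the least element, with height sequence (1,2,…,n).
≼bottom : ∀ {n} → DyckA n → Set
≼bottom {n} p = ∀ i → 1 ≤ i → i ≤ n → h p i ≤ i

-- "x ∧ z ≤ 0̂", unfolded through the universal property of the meet: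
-- every common lower bound of x and z is ≤ 0̂.
MeetBelowBottom : ∀ {n} → DyckA n → DyckA n → Set
MeetBelowBottom {n} x z = ∀ (v : DyckA n) → v ≼ x → v ≼ z → ≼bottom v

IsPseudocomplement : ∀ {n} → DyckA n → DyckA n → Set
IsPseudocomplement {n} x z =
  MeetBelowBottom x z × (∀ (w : DyckA n) → MeetBelowBottom x w → w ≼ z)

Regular : ∀ {n} → DyckA n → Set
Regular {n} x = Σ (DyckA n) λ c → Σ (DyckA n) λ cc →
  IsPseudocomplement x c × IsPseudocomplement c cc × word cc ≡ word x

Condition : ∀ {n} → DyckA n → Set
Condition {n} p = ∀ i → 1 ≤ i → i ≤ n →
  (h p i ≡ i) ⊎ (i < h p i × (∀ j → i ≤ j → j ≤ h p i → h p j ≡ h p i))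

-- Dyck paths in D_n^A correspond exactly to height sequences: functions f on
-- [1,n] with j ≤ f j ≤ n that are weakly increasing, ordered componentwise,
-- with meets computed pointwise by ⊓.  Hence x ∧ z = 0̂ means that at every
-- position one of x, z lies on the diagonal, and the pseudocomplement of x has
-- at position j the first k ≥ j where x lies strictly above the diagonal (or n
-- if there is none).  Since x^c lies strictly above the diagonal at k < n
-- exactly when x touches it at k, the double pseudocomplement has at position
-- j the first fixed point of h_x from j on.  So x is regular iff h_x j is
-- that first fixed point for every j, which is the stated condition.
module Submission where

open import Defs
open import Data.Nat using (ℕ; zero; suc; _+_; _∸_; _≤_; _<_; z≤n; s≤s; _⊓_; _≤?_; _<?_)
open import Data.Nat.Properties
open import Data.List using (List; []; _∷_; length; take; _++_; replicate)
open import Data.Product using (_×_; _,_; proj₁; proj₂)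
open import Data.Sum using (_⊎_; inj₁; inj₂)
open import Data.Empty using (⊥-elim)
open import Function using (_∘_)
open import Relation.Nullary using (¬_; yes; no)
open import Relation.Binary.PropositionalEquality

record HeightSequence (n : ℕ) (f : ℕ → ℕ) : Set where
  field
    above-diagonal : ∀ j → 1 ≤ j → j ≤ n → j ≤ f j
    bounded        : ∀ j → 1 ≤ j → j ≤ n → f j ≤ n
    monotone       : ∀ j → 1 ≤ j → suc j ≤ n → f j ≤ f (suc j)

  ends-on-diagonal : 1 ≤ n → f n ≡ n
  ends-on-diagonal 1≤n = ≤-antisym (bounded n 1≤n ≤-refl) (above-diagonal n 1≤n ≤-refl)

  monotone-≤ : ∀ i j → 1 ≤ i → i ≤ j → j ≤ n → f i ≤ f j
  monotone-≤ i zero    1≤i i≤0   _     = ⊥-elim (<⇒≱ 1≤i i≤0)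
  monotone-≤ i (suc j) 1≤i i≤1+j 1+j≤n with m≤n⇒m<n∨m≡n i≤1+j
  ... | inj₂ refl      = ≤-refl
  ... | inj₁ (s≤s i≤j) =
    ≤-trans (monotone-≤ i j 1≤i i≤j (≤-trans (n≤1+n j) 1+j≤n))
            (monotone j (≤-trans 1≤i i≤j) 1+j≤n)

⊓-heightSequence : ∀ {n f g} → HeightSequence n f → HeightSequence n g →
                   HeightSequence n (λ j → f j ⊓ g j)
⊓-heightSequence F G = record
  { above-diagonal = λ j 1≤j j≤n → ⊓-glb (F.above-diagonal j 1≤j j≤n) (G.above-diagonal j 1≤j j≤n)
  ; bounded        = λ j 1≤j j≤n → ≤-trans (m⊓n≤m _ _) (F.bounded j 1≤j j≤n)
  ; monotone       = λ j 1≤j 1+j≤n → ⊓-mono-≤ (F.monotone j 1≤j 1+j≤n) (G.monotone j 1≤j 1+j≤n)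
  }
  where
    module F = HeightSequence F
    module G = HeightSequence G

-- Reading the heights of a word

Ballot : ℕ → ℕ → List Letter → Set
Ballot a b w = ∀ k → b + #r (take k w) ≤ a + #u (take k w)

ballot-[] : ∀ {a b} → b ≤ a → Ballot a b []
ballot-[] b≤a zero    = +-monoˡ-≤ 0 b≤a
ballot-[] b≤a (suc k) = +-monoˡ-≤ 0 b≤a

ballot-u⁻ : ∀ {a b w} → Ballot a b (u ∷ w) → Ballot (suc a) b w
ballot-u⁻ {a} {b} {w} B k = subst (b + #r (take k w) ≤_) (+-suc a _) (B (suc k))

ballot-u⁺ : ∀ {a b w} → Ballot (suc a) b w → b ≤ a → Ballot a b (u ∷ w)
ballot-u⁺     B b≤a zero    = +-monoˡ-≤ 0 b≤a
ballot-u⁺ {a} {b} {w} B b≤a (suc k) = subst (b + #r (take k w) ≤_) (sym (+-suc a _)) (B k)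

ballot-r⁻ : ∀ {a b w} → Ballot a b (r ∷ w) → suc b ≤ a × Ballot a (suc b) w
ballot-r⁻ {a} {b} {w} B =
  subst₂ _≤_ (+-comm b 1) (+-identityʳ a) (B 1) ,
  λ k → subst (_≤ a + #u (take k w)) (+-suc b _) (B (suc k))

ballot-r⁺ : ∀ {a b w} → Ballot a (suc b) w → suc b ≤ a → Ballot a b (r ∷ w)
ballot-r⁺         B 1+b≤a zero    = +-monoˡ-≤ 0 (≤-trans (n≤1+n _) 1+b≤a)
ballot-r⁺ {a} {b} {w} B 1+b≤a (suc k) = subst (_≤ a + #u (take k w)) (sym (+-suc b _)) (B k)

ballot-replicate : ∀ c {a b w} → Ballot (c + a) b w → b ≤ a → Ballot a b (replicate c u ++ w)
ballot-replicate zero    B b≤a = B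
ballot-replicate (suc c) {a} {b} {w} B b≤a =
  ballot-u⁺ (ballot-replicate c (subst (λ a′ → Ballot a′ b w) (sym (+-suc c a)) B)
                                (≤-trans b≤a (n≤1+n a)))
            b≤a

heightAux-lower : ∀ w {a b} i → Ballot a b w → 1 ≤ i → i ≤ #r w → b + i ≤ heightAux a w i
heightAux-lower []      (suc i) B _ ()
heightAux-lower (u ∷ w) i B 1≤i i≤#r = heightAux-lower w i (ballot-u⁻ B) 1≤i i≤#r
heightAux-lower (r ∷ w) {a} {b} (suc zero) B _ _ = subst (_≤ a) (+-comm 1 b) (proj₁ (ballot-r⁻ B))
heightAux-lower (r ∷ w) {a} {b} (suc (suc i)) B _ (s≤s i≤#r) =
  subst (_≤ heightAux a w (suc i)) (sym (+-suc b (suc i)))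
        (heightAux-lower w (suc i) (proj₂ (ballot-r⁻ B)) (s≤s z≤n) i≤#r)

heightAux-start : ∀ w {a} i → 1 ≤ i → i ≤ #r w → a ≤ heightAux a w i
heightAux-start []      (suc i) _ ()
heightAux-start (u ∷ w) i 1≤i i≤#r = ≤-trans (n≤1+n _) (heightAux-start w i 1≤i i≤#r)
heightAux-start (r ∷ w) (suc zero)    _ _          = ≤-refl
heightAux-start (r ∷ w) (suc (suc i)) _ (s≤s i≤#r) = heightAux-start w (suc i) (s≤s z≤n) i≤#r

heightAux-mono : ∀ w {a} i → 1 ≤ i → suc i ≤ #r w → heightAux a w i ≤ heightAux a w (suc i)
heightAux-mono []      (suc i) _ ()
heightAux-mono (u ∷ w) i 1≤i i<#r = heightAux-mono w i 1≤i i<#r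
heightAux-mono (r ∷ w) (suc zero)    _ (s≤s i<#r) = heightAux-start w 1 (s≤s z≤n) i<#r
heightAux-mono (r ∷ w) (suc (suc i)) _ (s≤s i<#r) = heightAux-mono w (suc i) (s≤s z≤n) i<#r

heightAux-upper : ∀ w {a} i → heightAux a w i ≤ a + #u w
heightAux-upper []      i = z≤n
heightAux-upper (u ∷ w) {a} i = subst (heightAux (suc a) w i ≤_) (sym (+-suc a (#u w))) (heightAux-upper w i)
heightAux-upper (r ∷ w) zero          = z≤n
heightAux-upper (r ∷ w) (suc zero)    = m≤m+n _ _
heightAux-upper (r ∷ w) (suc (suc i)) = heightAux-upper w (suc i)

heightSequence : ∀ {n} (p : DyckA n) → HeightSequence n (h p)
heightSequence {n} p = record
  { above-diagonal = λ j 1≤j j≤n → heightAux-lower (word p) j (prefixes p) 1≤j (≤#r j≤n)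
  ; bounded        = λ j _ _ → subst (h p j ≤_) (countU p) (heightAux-upper (word p) j)
  ; monotone       = λ j 1≤j 1+j≤n → heightAux-mono (word p) j 1≤j (≤#r 1+j≤n)
  }
  where
    ≤#r : ∀ {i} → i ≤ n → i ≤ #r (word p)
    ≤#r = subst (_ ≤_) (sym (countR p))

-- Every height sequence is the height sequence of a Dyck path

#u-replicate : ∀ c w → #u (replicate c u ++ w) ≡ c + #u w
#u-replicate zero    w = refl
#u-replicate (suc c) w = cong suc (#u-replicate c w)

#r-replicate : ∀ c w → #r (replicate c u ++ w) ≡ #r w
#r-replicate zero    w = refl
#r-replicate (suc c) w = #r-replicate c w

heightAux-replicate : ∀ c a w i → heightAux a (replicate c u ++ w) i ≡ heightAux (c + a) w i
heightAux-replicate zero    a w i = refl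
heightAux-replicate (suc c) a w i =
  trans (heightAux-replicate c (suc a) w i) (cong (λ b → heightAux b w i) (+-suc c a))

length≡#u+#r : ∀ w → length w ≡ #u w + #r w
length≡#u+#r []      = refl
length≡#u+#r (u ∷ w) = cong suc (length≡#u+#r w)
length≡#u+#r (r ∷ w) = trans (cong suc (length≡#u+#r w)) (sym (+-suc (#u w) (#r w)))

-- The word starting at height a whose m r's sit at heights g 0, …, g (m ∸ 1).
heightsWord : ℕ → (ℕ → ℕ) → ℕ → List Letter
heightsWord a g zero    = []
heightsWord a g (suc m) = replicate (g 0 ∸ a) u ++ r ∷ heightsWord (g 0) (g ∘ suc) m

Ascending : (ℕ → ℕ) → ℕ → Set
Ascending g m = ∀ k → suc k < m → g k ≤ g (suc k)

ascending-suc : ∀ {g m} → Ascending g (suc m) → Ascending (g ∘ suc) m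
ascending-suc asc k 2+k≤m = asc (suc k) (s≤s 2+k≤m)

#r-heightsWord : ∀ a g m → #r (heightsWord a g m) ≡ m
#r-heightsWord a g zero    = refl
#r-heightsWord a g (suc m) =
  trans (#r-replicate (g 0 ∸ a) _) (cong suc (#r-heightsWord (g 0) (g ∘ suc) m))

#u-heightsWord : ∀ a g m → a ≤ g 0 → Ascending g (suc m) → a + #u (heightsWord a g (suc m)) ≡ g m
#u-heightsWord a g m a≤g₀ asc = begin
  a + #u (replicate (g 0 ∸ a) u ++ r ∷ rest)  ≡⟨ cong (a +_) (#u-replicate (g 0 ∸ a) (r ∷ rest)) ⟩
  a + ((g 0 ∸ a) + #u rest)                   ≡⟨ sym (+-assoc a _ _) ⟩
  a + (g 0 ∸ a) + #u rest                     ≡⟨ cong (_+ #u rest) (m+[n∸m]≡n a≤g₀) ⟩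
  g 0 + #u rest                               ≡⟨ remaining m asc ⟩
  g m                                         ∎
  where
    open ≡-Reasoning
    rest = heightsWord (g 0) (g ∘ suc) m
    remaining : ∀ m → Ascending g (suc m) → g 0 + #u (heightsWord (g 0) (g ∘ suc) m) ≡ g m
    remaining zero     _   = +-identityʳ (g 0)
    remaining (suc m′) asc = #u-heightsWord (g 0) (g ∘ suc) m′ (asc 0 (s≤s (s≤s z≤n))) (ascending-suc asc)

heightAux-heightsWord : ∀ a g m j → a ≤ g 0 → Ascending g m → j < m →
                        heightAux a (heightsWord a g m) (suc j) ≡ g j
heightAux-heightsWord a g (suc m) j a≤g₀ asc j<1+m = begin
  heightAux a (replicate (g 0 ∸ a) u ++ r ∷ rest) (suc j)
    ≡⟨ heightAux-replicate (g 0 ∸ a) a (r ∷ rest) (suc j) ⟩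
  heightAux (g 0 ∸ a + a) (r ∷ rest) (suc j)
    ≡⟨ cong (λ b → heightAux b (r ∷ rest) (suc j)) (m∸n+n≡m a≤g₀) ⟩
  heightAux (g 0) (r ∷ rest) (suc j)
    ≡⟨ afterFirstR j j<1+m ⟩
  g j
    ∎
  where
    open ≡-Reasoning
    rest = heightsWord (g 0) (g ∘ suc) m
    afterFirstR : ∀ j → j < suc m → heightAux (g 0) (r ∷ rest) (suc j) ≡ g j
    afterFirstR zero     _               = refl
    afterFirstR (suc j′) (s≤s 1+j′<1+m)  =
      heightAux-heightsWord (g 0) (g ∘ suc) m j′ (asc 0 (s≤s (≤-trans (s≤s z≤n) 1+j′<1+m)))
                            (ascending-suc asc) 1+j′<1+m

ballot-heightsWord : ∀ a b g m → b ≤ a → (0 < m → a ≤ g 0) → Ascending g m →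
                     (∀ k → k < m → suc (k + b) ≤ g k) → Ballot a b (heightsWord a g m)
ballot-heightsWord a b g zero    b≤a _ _ _ = ballot-[] b≤a
ballot-heightsWord a b g (suc m) b≤a a≤g₀ asc clear =
  ballot-replicate (g 0 ∸ a)
    (subst (λ c → Ballot c b (r ∷ rest)) (sym (m∸n+n≡m (a≤g₀ (s≤s z≤n))))
      (ballot-r⁺ (ballot-heightsWord (g 0) (suc b) (g ∘ suc) m (clear 0 (s≤s z≤n))
                    (λ 0<m → asc 0 (s≤s 0<m)) (ascending-suc asc) clear′)
                 (clear 0 (s≤s z≤n))))
    b≤a
  where
    rest = heightsWord (g 0) (g ∘ suc) m
    clear′ : ∀ k → k < m → suc (k + suc b) ≤ g (suc k)
    clear′ k k<m = subst (λ c → suc c ≤ g (suc k)) (sym (+-suc k b)) (clear (suc k) (s≤s k<m))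

heightSequence-ascending : ∀ {n f} → HeightSequence n f → Ascending (f ∘ suc) n
heightSequence-ascending F k 2+k≤n = HeightSequence.monotone F (suc k) (s≤s z≤n) 2+k≤n

#u-fromHeights : ∀ {n f} → HeightSequence n f → #u (heightsWord 0 (f ∘ suc) n) ≡ n
#u-fromHeights {zero}  F = refl
#u-fromHeights {suc m} F = trans (#u-heightsWord 0 _ m z≤n (heightSequence-ascending F))
                                 (HeightSequence.ends-on-diagonal F (s≤s z≤n))

module _ {n : ℕ} {f : ℕ → ℕ} (F : HeightSequence n f) where
  open HeightSequence F

  private
    g = f ∘ suc
    w = heightsWord 0 g n

  fromHeights : DyckA n
  fromHeights = dyck w
    (trans (length≡#u+#r w) (trans (cong₂ _+_ (#u-fromHeights F) (#r-heightsWord 0 g n))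
                                   (cong (n +_) (sym (+-identityʳ n)))))
    (#u-fromHeights F)
    (#r-heightsWord 0 g n)
    (ballot-heightsWord 0 0 g n z≤n (λ _ → z≤n) (heightSequence-ascending F) λ k k<n →
      subst (λ c → suc c ≤ g k) (sym (+-identityʳ k)) (above-diagonal (suc k) (s≤s z≤n) k<n))

  h-fromHeights : ∀ j → 1 ≤ j → j ≤ n → h fromHeights j ≡ f j
  h-fromHeights (suc j) _ 1+j≤n = heightAux-heightsWord 0 g n j z≤n (heightSequence-ascending F) 1+j≤n

-- Meets and the pseudocomplement

⊓≤⇒⊎ : ∀ {m n o} → m ⊓ n ≤ o → m ≤ o ⊎ n ≤ o
⊓≤⇒⊎ {m} {n} m⊓n≤o with ⊓-sel m n
... | inj₁ m⊓n≡m = inj₁ (subst (_≤ _) m⊓n≡m m⊓n≤o)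
... | inj₂ m⊓n≡n = inj₂ (subst (_≤ _) m⊓n≡n m⊓n≤o)

Disjoint : ∀ {n} → DyckA n → DyckA n → Set
Disjoint {n} x z = ∀ j → 1 ≤ j → j ≤ n → h x j ≤ j ⊎ h z j ≤ j

module _ {n : ℕ} (x z : DyckA n) where
  private
    heights-⊓ = ⊓-heightSequence (heightSequence x) (heightSequence z)

  meet : DyckA n
  meet = fromHeights heights-⊓

  h-meet : ∀ j → 1 ≤ j → j ≤ n → h meet j ≡ h x j ⊓ h z j
  h-meet = h-fromHeights heights-⊓

  meet≼ˡ : meet ≼ x
  meet≼ˡ j 1≤j j≤n = subst (_≤ h x j) (sym (h-meet j 1≤j j≤n)) (m⊓n≤m _ _)

  meet≼ʳ : meet ≼ z
  meet≼ʳ j 1≤j j≤n = subst (_≤ h z j) (sym (h-meet j 1≤j j≤n)) (m⊓n≤n _ _)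

  meetBelowBottom⇒disjoint : MeetBelowBottom x z → Disjoint x z
  meetBelowBottom⇒disjoint x∧z≤0̂ j 1≤j j≤n =
    ⊓≤⇒⊎ (subst (_≤ j) (h-meet j 1≤j j≤n) (x∧z≤0̂ meet meet≼ˡ meet≼ʳ j 1≤j j≤n))

  disjoint⇒meetBelowBottom : Disjoint x z → MeetBelowBottom x z
  disjoint⇒meetBelowBottom disjoint v v≼x v≼z j 1≤j j≤n with disjoint j 1≤j j≤n
  ... | inj₁ x≤j = ≤-trans (v≼x j 1≤j j≤n) x≤j
  ... | inj₂ z≤j = ≤-trans (v≼z j 1≤j j≤n) z≤j

record FirstAbove (X : ℕ → ℕ) (n j k : ℕ) : Set where
  field
    start≤ : j ≤ k
    ≤bound : k ≤ n
    hit    : k < X k ⊎ k ≡ n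
    below  : ∀ l → j ≤ l → l < k → X l ≤ l

firstAbove-mono : ∀ {X n j j′ k k′} →
                  FirstAbove X n j k → FirstAbove X n j′ k′ → j ≤ j′ → k ≤ k′
firstAbove-mono {k = k} {k′} S S′ j≤j′ with k ≤? k′ | FirstAbove.hit S′
... | yes k≤k′ | _           = k≤k′
... | no k≰k′  | inj₂ refl   = ⊥-elim (k≰k′ (FirstAbove.≤bound S))
... | no k≰k′  | inj₁ k′<Xk′ =
  ⊥-elim (<⇒≱ k′<Xk′ (FirstAbove.below S k′ (≤-trans j≤j′ (FirstAbove.start≤ S′)) (≰⇒> k≰k′)))

searchAbove : (ℕ → ℕ) → ℕ → ℕ → ℕ
searchAbove X j zero    = j
searchAbove X j (suc d) with j <? X j
... | yes _ = j
... | no  _ = searchAbove X (suc j) d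

firstAboveFrom : (ℕ → ℕ) → ℕ → ℕ → ℕ
firstAboveFrom X n j = searchAbove X j (n ∸ j)

searchAbove-firstAbove : ∀ X n d j → d + j ≡ n → FirstAbove X n j (searchAbove X j d)
searchAbove-firstAbove X n zero j refl = record
  { start≤ = ≤-refl ; ≤bound = ≤-refl ; hit = inj₂ refl
  ; below = λ l j≤l l<j → ⊥-elim (<⇒≱ l<j j≤l) }
searchAbove-firstAbove X n (suc d) j d+j≡n with j <? X j
... | yes j<Xj = record
  { start≤ = ≤-refl ; ≤bound = subst (j ≤_) d+j≡n (m≤n+m j (suc d)) ; hit = inj₁ j<Xj
  ; below = λ l j≤l l<j → ⊥-elim (<⇒≱ l<j j≤l) }
... | no j≮Xj = record
  { start≤ = ≤-trans (n≤1+n j) start≤ ; ≤bound = ≤bound ; hit = hit ; below = below′ }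
  where
    open FirstAbove (searchAbove-firstAbove X n d (suc j) (trans (+-suc d j) d+j≡n))
    below′ : ∀ l → j ≤ l → l < searchAbove X (suc j) d → X l ≤ l
    below′ l j≤l l<k with m≤n⇒m<n∨m≡n j≤l
    ... | inj₁ j<l  = below l j<l l<k
    ... | inj₂ refl = ≮⇒≥ j≮Xj

firstAboveFrom-firstAbove : ∀ X n j → j ≤ n → FirstAbove X n j (firstAboveFrom X n j)
firstAboveFrom-firstAbove X n j j≤n = searchAbove-firstAbove X n (n ∸ j) j (m∸n+n≡m j≤n)

module _ {n : ℕ} (x : DyckA n) where
  firstAbove⇒isPseudocomplement : ∀ z → (∀ j → 1 ≤ j → j ≤ n → FirstAbove (h x) n j (h z j)) →
                                  IsPseudocomplement x z
  firstAbove⇒isPseudocomplement z S = disjoint⇒meetBelowBottom x z disjoint , maximal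
    where
      disjoint : Disjoint x z
      disjoint j 1≤j j≤n with h x j ≤? j | h z j ≤? j
      ... | yes x≤j | _        = inj₁ x≤j
      ... | no _    | yes z≤j  = inj₂ z≤j
      ... | no x≰j  | no z≰j   = ⊥-elim (x≰j (FirstAbove.below (S j 1≤j j≤n) j ≤-refl (≰⇒> z≰j)))

      maximal : ∀ w → MeetBelowBottom x w → w ≼ z
      maximal w x∧w≤0̂ j 1≤j j≤n = bounded-by hit
        where
          open FirstAbove (S j 1≤j j≤n)
          open HeightSequence (heightSequence w)
          k = h z j
          bounded-by : k < h x k ⊎ k ≡ n → h w j ≤ k
          bounded-by (inj₂ k≡n)  = subst (h w j ≤_) (sym k≡n) (bounded j 1≤j j≤n)
          bounded-by (inj₁ k<xk) with meetBelowBottom⇒disjoint x w x∧w≤0̂ k (≤-trans 1≤j start≤) ≤bound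
          ... | inj₁ xk≤k = ⊥-elim (<⇒≱ k<xk xk≤k)
          ... | inj₂ wk≤k = ≤-trans (monotone-≤ j k 1≤j start≤ ≤bound) wk≤k

  private
    pseudocomplementHeights : HeightSequence n (firstAboveFrom (h x) n)
    pseudocomplementHeights = record
      { above-diagonal = λ j _ j≤n → FirstAbove.start≤ (firstAboveFrom-firstAbove (h x) n j j≤n)
      ; bounded        = λ j _ j≤n → FirstAbove.≤bound (firstAboveFrom-firstAbove (h x) n j j≤n)
      ; monotone       = λ j _ 1+j≤n → firstAbove-mono (firstAboveFrom-firstAbove (h x) n j (<⇒≤ 1+j≤n))
                                                        (firstAboveFrom-firstAbove (h x) n (suc j) 1+j≤n)
                                                        (n≤1+n j)
      }

  pseudocomplement : DyckA n
  pseudocomplement = fromHeights pseudocomplementHeights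

  h-pseudocomplement : ∀ j → 1 ≤ j → j ≤ n → FirstAbove (h x) n j (h pseudocomplement j)
  h-pseudocomplement j 1≤j j≤n =
    subst (FirstAbove (h x) n j) (sym (h-fromHeights pseudocomplementHeights j 1≤j j≤n))
          (firstAboveFrom-firstAbove (h x) n j j≤n)

  pseudocomplement-isPseudocomplement : IsPseudocomplement x pseudocomplement
  pseudocomplement-isPseudocomplement = firstAbove⇒isPseudocomplement pseudocomplement h-pseudocomplement

  isPseudocomplement⇒firstAbove : ∀ z → IsPseudocomplement x z →
                                  ∀ j → 1 ≤ j → j ≤ n → FirstAbove (h x) n j (h z j)
  isPseudocomplement⇒firstAbove z (x∧z≤0̂ , maximal-z) j 1≤j j≤n =
    subst (FirstAbove (h x) n j) (≤-antisym c≤z z≤c) (h-pseudocomplement j 1≤j j≤n)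
    where
      c≤z = maximal-z pseudocomplement (proj₁ pseudocomplement-isPseudocomplement) j 1≤j j≤n
      z≤c = proj₂ pseudocomplement-isPseudocomplement z x∧z≤0̂ j 1≤j j≤n

-- The double pseudocomplement

record FirstFixed (X : ℕ → ℕ) (n j k : ℕ) : Set where
  field
    start≤ : j ≤ k
    ≤bound : k ≤ n
    fixed  : X k ≡ k
    above  : ∀ l → j ≤ l → l < k → l < X l

firstFixed-least : ∀ {X n j k k′} → FirstFixed X n j k → j ≤ k′ → X k′ ≡ k′ → k ≤ k′
firstFixed-least {k = k} {k′} F j≤k′ Xk′≡k′ with k ≤? k′
... | yes k≤k′ = k≤k′
... | no k≰k′  = ⊥-elim (<⇒≢ (FirstFixed.above F k′ j≤k′ (≰⇒> k≰k′)) (sym Xk′≡k′))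

module _ {n : ℕ} {X Y : ℕ → ℕ} (HX : HeightSequence n X)
         (Y-firstAbove : ∀ k → 1 ≤ k → k ≤ n → FirstAbove X n k (Y k)) where
  open HeightSequence HX

  hit⇒fixed : ∀ k → 1 ≤ k → k ≤ n → k < Y k ⊎ k ≡ n → X k ≡ k
  hit⇒fixed k 1≤k k≤n (inj₂ refl) = ends-on-diagonal 1≤k
  hit⇒fixed k 1≤k k≤n (inj₁ k<Yk) =
    ≤-antisym (FirstAbove.below (Y-firstAbove k 1≤k k≤n) k ≤-refl k<Yk) (above-diagonal k 1≤k k≤n)

  fixed⇒hit : ∀ k → 1 ≤ k → k ≤ n → X k ≡ k → k < Y k ⊎ k ≡ n
  fixed⇒hit k 1≤k k≤n Xk≡k with m≤n⇒m<n∨m≡n (FirstAbove.start≤ (Y-firstAbove k 1≤k k≤n))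
  ... | inj₁ k<Yk = inj₁ k<Yk
  ... | inj₂ k≡Yk
    with subst (λ m → m < X m ⊎ m ≡ n) (sym k≡Yk) (FirstAbove.hit (Y-firstAbove k 1≤k k≤n))
  ...   | inj₁ k<Xk = ⊥-elim (<⇒≢ k<Xk (sym Xk≡k))
  ...   | inj₂ k≡n  = inj₂ k≡n

  firstAbove⇒firstFixed : ∀ {j k} → 1 ≤ j → FirstAbove Y n j k → FirstFixed X n j k
  firstAbove⇒firstFixed {j} {k} 1≤j S = record
    { start≤ = start≤ ; ≤bound = ≤bound
    ; fixed  = hit⇒fixed k (≤-trans 1≤j start≤) ≤bound hit
    ; above  = above }
    where
      open FirstAbove S
      above : ∀ l → j ≤ l → l < k → l < X l
      above l j≤l l<k =
        ≤∧≢⇒< (above-diagonal l 1≤l l≤n) (λ l≡Xl → no-hit (fixed⇒hit l 1≤l l≤n (sym l≡Xl)))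
        where
          1≤l = ≤-trans 1≤j j≤l
          l≤n = ≤-trans (<⇒≤ l<k) ≤bound
          no-hit : ¬ (l < Y l ⊎ l ≡ n)
          no-hit (inj₁ l<Yl) = <⇒≱ l<Yl (below l j≤l l<k)
          no-hit (inj₂ l≡n)  = <⇒≢ (≤-trans l<k ≤bound) l≡n

  firstFixed⇒firstAbove : ∀ {j k} → 1 ≤ j → FirstFixed X n j k → FirstAbove Y n j k
  firstFixed⇒firstAbove {j} {k} 1≤j F = record
    { start≤ = start≤ ; ≤bound = ≤bound
    ; hit    = fixed⇒hit k (≤-trans 1≤j start≤) ≤bound fixed
    ; below  = below }
    where
      open FirstFixed F
      below : ∀ l → j ≤ l → l < k → Y l ≤ l
      below l j≤l l<k = ≮⇒≥ λ l<Yl →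
        <⇒≢ (above l j≤l l<k) (sym (hit⇒fixed l 1≤l l≤n (inj₁ l<Yl)))
        where
          1≤l = ≤-trans 1≤j j≤l
          l≤n = ≤-trans (<⇒≤ l<k) ≤bound

module _ {n : ℕ} (p : DyckA n) where
  open HeightSequence (heightSequence p)

  condition⇒firstFixed : Condition p → ∀ j → 1 ≤ j → j ≤ n → FirstFixed (h p) n j (h p j)
  condition⇒firstFixed C j 1≤j j≤n with C j 1≤j j≤n
  ... | inj₁ hj≡j = record
    { start≤ = above-diagonal j 1≤j j≤n ; ≤bound = bounded j 1≤j j≤n ; fixed = cong (h p) hj≡j
    ; above = λ l j≤l l<hj → ⊥-elim (<⇒≱ l<hj (subst (_≤ l) (sym hj≡j) j≤l)) }
  ... | inj₂ (j<hj , constant) = record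
    { start≤ = <⇒≤ j<hj ; ≤bound = bounded j 1≤j j≤n ; fixed = constant (h p j) (<⇒≤ j<hj) ≤-refl
    ; above = λ l j≤l l<hj → subst (l <_) (sym (constant l j≤l (<⇒≤ l<hj))) l<hj }

  firstFixed⇒condition : (∀ j → 1 ≤ j → j ≤ n → FirstFixed (h p) n j (h p j)) → Condition p
  firstFixed⇒condition F i 1≤i i≤n with m≤n⇒m<n∨m≡n (above-diagonal i 1≤i i≤n)
  ... | inj₂ i≡hi = inj₁ (sym i≡hi)
  ... | inj₁ i<hi = inj₂ (i<hi , constant)
    where
      constant : ∀ j → i ≤ j → j ≤ h p i → h p j ≡ h p i
      constant j i≤j j≤hi = ≤-antisym
        (firstFixed-least Fj j≤hi (FirstFixed.fixed Fi))
        (firstFixed-least Fi (≤-trans i≤j (FirstFixed.start≤ Fj)) (FirstFixed.fixed Fj))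
        where
          Fi = F i 1≤i i≤n
          Fj = F j (≤-trans 1≤i i≤j) (≤-trans j≤hi (bounded i 1≤i i≤n))

proposition3p8 : (n : ℕ) (p : DyckA n) → (Regular p → Condition p) × (Condition p → Regular p)
proposition3p8 n p = regular⇒condition , condition⇒regular
  where
    regular⇒condition : Regular p → Condition p
    regular⇒condition (c , cc , c-is-pᶜ , cc-is-cᶜ , cc≡p) = firstFixed⇒condition p λ j 1≤j j≤n →
      subst (FirstFixed (h p) n j) (cong (λ w → heightAux 0 w j) cc≡p)
        (firstAbove⇒firstFixed (heightSequence p) (isPseudocomplement⇒firstAbove p c c-is-pᶜ) 1≤j
          (isPseudocomplement⇒firstAbove c cc cc-is-cᶜ j 1≤j j≤n))

    -- p itself witnesses (p^c)^c, so heights never have to determine the word.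
    condition⇒regular : Condition p → Regular p
    condition⇒regular C =
      pseudocomplement p , p , pseudocomplement-isPseudocomplement p ,
      firstAbove⇒isPseudocomplement (pseudocomplement p) p (λ j 1≤j j≤n →
        firstFixed⇒firstAbove (heightSequence p) (h-pseudocomplement p) 1≤j
          (condition⇒firstFixed p C j 1≤j j≤n)) ,
      refl
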